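{- Let $G=(V,E)$ be a simple graph, $C\subseteq E$, and $H=(V,A)$ a directed subgraph of $G$ that is $(\alpha,\beta)$-good for contracting with respect to $C$. Then the probability that no edge of $C$ is selected in a random 1-out sample of $H$ is at least $(1-\alpha)^{\lceil\beta/\alpha\rceil}$.
   Context: A simple graph is undirected, unweighted, loopless, with at most one edge per pair of vertices. A directed graph $H=(V,A)$ is a directed subgraph of $G$ if every arc $(u,v)\in A$ satisfies $\{u,v\}\in E$. A random 1-out sample of $H$ is obtained by choosing, independently for each vertex that has at least one outgoing arc in $H$, one of its outgoing arcs uniformly at random; an edge $\{u,v\}$ is selected if an arc $(u,v)$ or $(v,u)$ is chosen. For $u\in V$, let $q_u$ be the fraction of outgoing arcs $(u,v)\in A$ with $\{u,v\}\in C$ if $u$ has an outgoing arc, and $q_u=0$ otherwise. $H$ is $(\alpha,\beta)$-good for contracting with respect to $C$ if $\max_u q_u\le\alpha$ and $\sum_u q_u\le\beta$. -}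

module Defs where

open import Data.Nat as ℕ using (ℕ; zero; suc)
open import Data.Integer using (+_)
open import Data.Bool using (Bool; true; false; not; _∧_)
open import Data.Fin using (Fin)
open import Data.List using (List; []; _∷_; map; concatMap; filter; length; foldr)
open import Data.List.Base using (allFin)
open import Data.Product using (_×_; _,_; proj₁; proj₂)
open import Data.Rational using (ℚ; 0ℚ; 1ℚ; _+_; _*_; _/_)
open import Relation.Binary.PropositionalEquality using (_≡_)
open import Relation.Nullary.Decidable using (does)
open import Data.Bool.Properties using (T?)

_^ℚ_ : ℚ → ℕ → ℚ
q ^ℚ zero = 1ℚ
q ^ℚ suc k = q * (q ^ℚ k)

-- a / b as a rational, with the convention a / 0 = 0.
ratio : ℕ → ℕ → ℚ
ratio a zero = 0ℚ
ratio a (suc b) = (+ a) / suc b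

record SimpleGraph (n : ℕ) : Set where
  field
    adj       : Fin n → Fin n → Bool
    symmetric : ∀ u v → adj u v ≡ adj v u
    loopless  : ∀ u → adj u u ≡ false
open SimpleGraph public

record EdgeSubset {n : ℕ} (G : SimpleGraph n) : Set where
  field
    inC       : Fin n → Fin n → Bool
    symmetricC : ∀ u v → inC u v ≡ inC v u
    subsetC   : ∀ u v → inC u v ≡ true → adj G u v ≡ true
open EdgeSubset public

record DirectedSubgraph {n : ℕ} (G : SimpleGraph n) : Set where
  field
    arc      : Fin n → Fin n → Bool
    arc⊆edge : ∀ u v → arc u v ≡ true → adj G u v ≡ true
open DirectedSubgraph public

module _ {n : ℕ} {G : SimpleGraph n} where

  outs : DirectedSubgraph G → Fin n → List (Fin n)
  outs H u = filter (λ v → T? (arc H u v)) (allFin n)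

  outsInC : DirectedSubgraph G → EdgeSubset G → Fin n → ℕ
  outsInC H C u = length (filter (λ v → T? (inC C u v)) (outs H u))

  -- q_u (0 if u has no outgoing arc)
  q : DirectedSubgraph G → EdgeSubset G → Fin n → ℚ
  q H C u = ratio (outsInC H C u) (length (outs H u))

  sumℚ : List ℚ → ℚ
  sumℚ = foldr _+_ 0ℚ

  Good : DirectedSubgraph G → EdgeSubset G → ℚ → ℚ → Set
  Good H C α β =
    (∀ u → q H C u Data.Rational.≤ α) ×
    (sumℚ (map (q H C) (allFin n)) Data.Rational.≤ β)

  -- Each outcome is the list of chosen arcs; all outcomes are
  -- equally likely (independent uniform choices).
  choicesFrom : DirectedSubgraph G → List (Fin n) → List (List (Fin n × Fin n))
  choicesFrom H [] = [] ∷ []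
  choicesFrom H (u ∷ us) with outs H u
  ... | [] = choicesFrom H us
  ... | vs@(_ ∷ _) =
        concatMap (λ v → map ((u , v) ∷_) (choicesFrom H us)) vs

  samples : DirectedSubgraph G → List (List (Fin n × Fin n))
  samples H = choicesFrom H (allFin n)

  avoidsC : EdgeSubset G → List (Fin n × Fin n) → Bool
  avoidsC C s = foldr (λ a b → not (inC C (proj₁ a) (proj₂ a)) ∧ b) true s

  probNoC : DirectedSubgraph G → EdgeSubset G → ℚ
  probNoC H C =
    ratio (length (filter (λ s → T? (avoidsC C s)) (samples H)))
          (length (samples H))

-- Since the out-arcs are chosen independently and uniformly, the probability that no edge of C
-- is selected factorises as ∏ (1 - q_u).  Every q_u lies in [0, α] and their sum is at most
-- β ≤ ⌈β/α⌉ α.  For a fixed sum, (1 - a)(1 - b) only decreases when a and b are spread apart,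
-- so the product is smallest when the mass is packed into ⌈β/α⌉ factors equal to α.

module Submission where

open import Defs
open import Data.Nat using (ℕ)
open import Data.Integer using (∣_∣)
open import Data.Rational using (ℚ; 0ℚ; 1ℚ; _≤_; _<_; _-_; _÷_; ceiling; >-nonZero)

open import Data.Nat as ℕ using (zero; suc)
import Data.Nat.Properties as ℕₚ
open import Data.Nat.Tactic.RingSolver using (solve-∀)
open import Data.Integer as ℤ using (+_)
import Data.Integer.Properties as ℤₚ
open import Data.Integer.DivMod using ([n/d]*d≤n)
open import Data.Rational using (mkℚ; NonZero; _+_; _*_; _/_; -_; 1/_; ↥_; ↧_; toℚᵘ; nonNegative)
open import Data.Rational.Properties
import Data.Rational.Unnormalised as ℚᵘ
import Data.Rational.Unnormalised.Properties as ℚᵘₚ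
open import Data.Rational.Solver using (module +-*-Solver)
open +-*-Solver using (solve; _:=_; _:+_; _:*_; _:-_; con)
open import Data.Bool using (Bool; true; false; not; _∧_; if_then_else_)
open import Data.Bool.Properties using (T?)
open import Data.Product using (_×_; _,_; proj₁; proj₂)
open import Data.List using (List; []; _∷_; _++_; map; concatMap; filter; length; foldr; allFin)
open import Data.List.Properties using (length-++; length-map; filter-++)
open import Data.List.Relation.Unary.All as All using (All; []; _∷_)
open import Data.List.Relation.Unary.All.Properties using (map⁺)
open import Data.Empty using (⊥-elim)
open import Relation.Nullary using (Dec; yes; no)
open import Relation.Binary.PropositionalEquality

fromℕ : ℕ → ℚ
fromℕ k = + k / 1

toℚᵘ-ratio : ∀ a b → toℚᵘ (ratio a (suc b)) ℚᵘ.≃ ℚᵘ.mkℚᵘ (+ a) b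
toℚᵘ-ratio a b = toℚᵘ-fromℚᵘ (ℚᵘ.mkℚᵘ (+ a) b)

mkℚᵘ-≃ : ∀ {a b c d} → a ℕ.* suc d ≡ c ℕ.* suc b → ℚᵘ.mkℚᵘ (+ a) b ℚᵘ.≃ ℚᵘ.mkℚᵘ (+ c) d
mkℚᵘ-≃ {a} {b} {c} {d} eq =
  ℚᵘ.*≡* (trans (sym (ℤₚ.pos-* a (suc d))) (trans (cong +_ eq) (ℤₚ.pos-* c (suc b))))

ratio-self : ∀ b → ratio (suc b) (suc b) ≡ 1ℚ
ratio-self b = toℚᵘ-injective (ℚᵘₚ.≃-trans (toℚᵘ-ratio (suc b) b) (mkℚᵘ-≃ (ℕₚ.*-comm (suc b) 1)))

ratio-+ : ∀ a c b → ratio a (suc b) + ratio c (suc b) ≡ ratio (a ℕ.+ c) (suc b)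
ratio-+ a c b = toℚᵘ-injective (begin
  toℚᵘ (ratio a (suc b) + ratio c (suc b))
    ≈⟨ toℚᵘ-homo-+ (ratio a (suc b)) (ratio c (suc b)) ⟩
  toℚᵘ (ratio a (suc b)) ℚᵘ.+ toℚᵘ (ratio c (suc b))
    ≈⟨ ℚᵘₚ.+-cong (toℚᵘ-ratio a b) (toℚᵘ-ratio c b) ⟩
  ℚᵘ.mkℚᵘ (+ a ℤ.* + suc b ℤ.+ + c ℤ.* + suc b) (b ℕ.+ b ℕ.* suc b)
    ≡⟨ cong (λ i → ℚᵘ.mkℚᵘ i (b ℕ.+ b ℕ.* suc b)) numerator ⟩
  ℚᵘ.mkℚᵘ (+ (a ℕ.* suc b ℕ.+ c ℕ.* suc b)) (b ℕ.+ b ℕ.* suc b)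
    ≈⟨ mkℚᵘ-≃ (distrib a c (suc b)) ⟩
  ℚᵘ.mkℚᵘ (+ (a ℕ.+ c)) b
    ≈⟨ ℚᵘₚ.≃-sym (toℚᵘ-ratio (a ℕ.+ c) b) ⟩
  toℚᵘ (ratio (a ℕ.+ c) (suc b)) ∎)
  where
  open ℚᵘₚ.≃-Reasoning
  numerator : + a ℤ.* + suc b ℤ.+ + c ℤ.* + suc b ≡ + (a ℕ.* suc b ℕ.+ c ℕ.* suc b)
  numerator = trans (cong₂ ℤ._+_ (sym (ℤₚ.pos-* a (suc b))) (sym (ℤₚ.pos-* c (suc b))))
                    (sym (ℤₚ.pos-+ (a ℕ.* suc b) (c ℕ.* suc b)))
  distrib : ∀ a c s → (a ℕ.* s ℕ.+ c ℕ.* s) ℕ.* s ≡ (a ℕ.+ c) ℕ.* (s ℕ.* s)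
  distrib = solve-∀

ratio-* : ∀ a b c d → ratio (a ℕ.* c) (b ℕ.* d) ≡ ratio a b * ratio c d
ratio-* a zero c d = sym (*-zeroˡ (ratio c d))
ratio-* a (suc b) c zero rewrite ℕₚ.*-zeroʳ (suc b) = sym (*-zeroʳ (ratio a (suc b)))
ratio-* a (suc b) c (suc d) = toℚᵘ-injective (begin
  toℚᵘ (ratio (a ℕ.* c) (suc b ℕ.* suc d))
    ≈⟨ toℚᵘ-ratio (a ℕ.* c) (d ℕ.+ b ℕ.* suc d) ⟩
  ℚᵘ.mkℚᵘ (+ (a ℕ.* c)) (d ℕ.+ b ℕ.* suc d)
    ≡⟨ cong (λ i → ℚᵘ.mkℚᵘ i (d ℕ.+ b ℕ.* suc d)) (ℤₚ.pos-* a c) ⟩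
  ℚᵘ.mkℚᵘ (+ a) b ℚᵘ.* ℚᵘ.mkℚᵘ (+ c) d
    ≈⟨ ℚᵘₚ.*-cong (ℚᵘₚ.≃-sym (toℚᵘ-ratio a b)) (ℚᵘₚ.≃-sym (toℚᵘ-ratio c d)) ⟩
  toℚᵘ (ratio a (suc b)) ℚᵘ.* toℚᵘ (ratio c (suc d))
    ≈⟨ ℚᵘₚ.≃-sym (toℚᵘ-homo-* (ratio a (suc b)) (ratio c (suc d))) ⟩
  toℚᵘ (ratio a (suc b) * ratio c (suc d)) ∎)
  where open ℚᵘₚ.≃-Reasoning

ratio-complement : ∀ a c {b} → a ℕ.+ c ≡ suc b → 1ℚ - ratio a (suc b) ≡ ratio c (suc b)
ratio-complement a c {b} a+c≡1+b = begin
  1ℚ - x        ≡⟨ cong (_- x) (sym x+y≡1) ⟩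
  (x + y) - x   ≡⟨ cong (_- x) (+-comm x y) ⟩
  (y + x) - x   ≡⟨ +-assoc y x (- x) ⟩
  y + (x - x)   ≡⟨ cong (_+_ y) (+-inverseʳ x) ⟩
  y + 0ℚ        ≡⟨ +-identityʳ y ⟩
  y             ∎
  where
  open ≡-Reasoning
  x = ratio a (suc b)
  y = ratio c (suc b)
  x+y≡1 : x + y ≡ 1ℚ
  x+y≡1 = trans (ratio-+ a c b) (trans (cong (λ m → ratio m (suc b)) a+c≡1+b) (ratio-self b))

ratio-nonNeg : ∀ a b → 0ℚ ≤ ratio a b
ratio-nonNeg a zero    = ≤-refl
ratio-nonNeg a (suc b) = nonNegative⁻¹ (ratio a (suc b)) {{normalize-nonNeg a (suc b)}}

⌈⌉-defn : ∀ p → ⌈ p ⌉ ≡ ℤ.- ((ℤ.- ↥ p) ℤ./ ↧ p)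
⌈⌉-defn (mkℚ (+ zero) d _) = refl
⌈⌉-defn (mkℚ ℤ.+[1+ n ] d _) = refl
⌈⌉-defn (mkℚ ℤ.-[1+ n ] d _) = refl

↥≤⌈⌉*↧ : ∀ p → ↥ p ℤ.≤ ⌈ p ⌉ ℤ.* ↧ p
↥≤⌈⌉*↧ p = begin
  ↥ p                                   ≡⟨ ℤₚ.neg-involutive (↥ p) ⟨
  ℤ.- (ℤ.- ↥ p)                         ≤⟨ ℤₚ.neg-mono-≤ ([n/d]*d≤n (ℤ.- ↥ p) (↧ p)) ⟩
  ℤ.- ((ℤ.- ↥ p) ℤ./ ↧ p ℤ.* ↧ p)        ≡⟨ ℤₚ.neg-distribˡ-* ((ℤ.- ↥ p) ℤ./ ↧ p) (↧ p) ⟩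
  ℤ.- ((ℤ.- ↥ p) ℤ./ ↧ p) ℤ.* ↧ p        ≡⟨ cong (ℤ._* ↧ p) (⌈⌉-defn p) ⟨
  ⌈ p ⌉ ℤ.* ↧ p                          ∎
  where open ℤₚ.≤-Reasoning

i≤+∣i∣ : ∀ i → i ℤ.≤ + ∣ i ∣
i≤+∣i∣ (+ n)      = ℤₚ.≤-refl
i≤+∣i∣ ℤ.-[1+ n ] = ℤ.-≤+

≤-fromℕ-∣⌈⌉∣ : ∀ p → p ≤ fromℕ ∣ ⌈ p ⌉ ∣
≤-fromℕ-∣⌈⌉∣ p@record{} =
  toℚᵘ-cancel-≤ (ℚᵘₚ.≤-respʳ-≃ (ℚᵘₚ.≃-sym (toℚᵘ-ratio ∣ ⌈ p ⌉ ∣ 0)) (ℚᵘ.*≤* (begin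
    ↥ p ℤ.* + 1           ≡⟨ ℤₚ.*-identityʳ (↥ p) ⟩
    ↥ p                   ≤⟨ ↥≤⌈⌉*↧ p ⟩
    ⌈ p ⌉ ℤ.* ↧ p          ≤⟨ ℤₚ.*-monoʳ-≤-nonNeg (↧ p) (i≤+∣i∣ ⌈ p ⌉) ⟩
    + ∣ ⌈ p ⌉ ∣ ℤ.* ↧ p    ∎)))
  where open ℤₚ.≤-Reasoning

÷-* : ∀ p q .{{_ : NonZero q}} → (p ÷ q) * q ≡ p
÷-* p q = begin
  p * 1/ q * q     ≡⟨ *-assoc p (1/ q) q ⟩
  p * (1/ q * q)   ≡⟨ cong (_*_ p) (*-inverseˡ q) ⟩
  p * 1ℚ           ≡⟨ *-identityʳ p ⟩
  p                ∎
  where open ≡-Reasoning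

≤-fromℕ-∣⌈÷⌉∣-* : ∀ p q .{{_ : NonZero q}} → 0ℚ ≤ q → p ≤ fromℕ ∣ ⌈ p ÷ q ⌉ ∣ * q
≤-fromℕ-∣⌈÷⌉∣-* p q 0≤q = begin
  p             ≡⟨ ÷-* p q ⟨
  (p ÷ q) * q   ≤⟨ *-monoʳ-≤-nonNeg q {{nonNegative 0≤q}} (≤-fromℕ-∣⌈⌉∣ (p ÷ q)) ⟩
  fromℕ ∣ ⌈ p ÷ q ⌉ ∣ * q ∎
  where open ≤-Reasoning

p≤q⇒0≤q-p : ∀ {p q} → p ≤ q → 0ℚ ≤ q - p
p≤q⇒0≤q-p {p} {q} p≤q = subst (_≤ q - p) (+-inverseʳ p) (+-monoˡ-≤ (- p) p≤q)

p≤p+q : ∀ p {q} → 0ℚ ≤ q → p ≤ p + q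
p≤p+q p {q} 0≤q = subst (_≤ p + q) (+-identityʳ p) (+-monoʳ-≤ p 0≤q)

p+q-p≡q : ∀ p q → p + q - p ≡ q
p+q-p≡q = solve 2 (λ p q → p :+ q :- p := q) refl

*-nonNeg : ∀ {p q} → 0ℚ ≤ p → 0ℚ ≤ q → 0ℚ ≤ p * q
*-nonNeg {p} {q} 0≤p 0≤q = subst (_≤ p * q) (*-zeroʳ p) (*-monoˡ-≤-nonNeg p {{nonNegative 0≤p}} 0≤q)

infix 4 _∈[_,_]

_∈[_,_] : ℚ → ℚ → ℚ → Set
x ∈[ a , b ] = a ≤ x × x ≤ b

1-∈[0,1] : ∀ {p} → p ∈[ 0ℚ , 1ℚ ] → 1ℚ - p ∈[ 0ℚ , 1ℚ ]
1-∈[0,1] {p} (0≤p , p≤1) =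
  p≤q⇒0≤q-p p≤1 , subst (1ℚ - p ≤_) (+-identityʳ 1ℚ) (+-monoʳ-≤ 1ℚ (neg-antimono-≤ 0≤p))

*-∈[0,1] : ∀ {p q} → p ∈[ 0ℚ , 1ℚ ] → q ∈[ 0ℚ , 1ℚ ] → p * q ∈[ 0ℚ , 1ℚ ]
*-∈[0,1] {p} {q} (0≤p , p≤1) (0≤q , q≤1) =
  *-nonNeg 0≤p 0≤q ,
  ≤-trans (*-monoʳ-≤-nonNeg q {{nonNegative 0≤q}} p≤1) (subst (_≤ 1ℚ) (sym (*-identityˡ q)) q≤1)

^ℚ-∈[0,1] : ∀ {p} → p ∈[ 0ℚ , 1ℚ ] → ∀ k → p ^ℚ k ∈[ 0ℚ , 1ℚ ]
^ℚ-∈[0,1] p∈ zero    = nonNegative⁻¹ 1ℚ , ≤-refl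
^ℚ-∈[0,1] p∈ (suc k) = *-∈[0,1] p∈ (^ℚ-∈[0,1] p∈ k)

∑ : List ℚ → ℚ
∑ = foldr _+_ 0ℚ

∏[1-_] : List ℚ → ℚ
∏[1- xs ] = foldr (λ x p → (1ℚ - x) * p) 1ℚ xs

∑-nonNeg : ∀ {xs} → All (0ℚ ≤_) xs → 0ℚ ≤ ∑ xs
∑-nonNeg []           = ≤-refl
∑-nonNeg (0≤x ∷ 0≤xs) = +-mono-≤ 0≤x (∑-nonNeg 0≤xs)

1-*1-≤-spread : ∀ {a b c d} → b ≤ c → c ≤ a → a + b ≡ c + d →
                (1ℚ - a) * (1ℚ - b) ≤ (1ℚ - c) * (1ℚ - d)
1-*1-≤-spread {a} {b} {c} {d} b≤c c≤a a+b≡c+d = begin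
  (1ℚ - a) * (1ℚ - b)
    ≤⟨ p≤p+q _ (*-nonNeg (p≤q⇒0≤q-p c≤a) (p≤q⇒0≤q-p b≤c)) ⟩
  (1ℚ - a) * (1ℚ - b) + (a - c) * (c - b)
    ≡⟨ expand a b c ⟩
  (1ℚ - c) * (1ℚ - (a + b - c))
    ≡⟨ cong (λ e → (1ℚ - c) * (1ℚ - (e - c))) a+b≡c+d ⟩
  (1ℚ - c) * (1ℚ - (c + d - c))
    ≡⟨ cong (λ e → (1ℚ - c) * (1ℚ - e)) (p+q-p≡q c d) ⟩
  (1ℚ - c) * (1ℚ - d) ∎
  where
  open ≤-Reasoning
  expand : ∀ a b c → (1ℚ - a) * (1ℚ - b) + (a - c) * (c - b) ≡ (1ℚ - c) * (1ℚ - (a + b - c))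
  expand = solve 3 (λ a b c → (con 1ℚ :- a) :* (con 1ℚ :- b) :+ (a :- c) :* (c :- b)
                              := (con 1ℚ :- c) :* (con 1ℚ :- (a :+ b :- c))) refl

*-≤-via : ∀ {p u v w y} → 0ℚ ≤ p → 0ℚ ≤ u → y ≤ u * v → p * v ≤ w → p * y ≤ u * w
*-≤-via {p} {u} {v} {w} {y} 0≤p 0≤u y≤uv pv≤w = begin
  p * y         ≤⟨ *-monoˡ-≤-nonNeg p {{nonNegative 0≤p}} y≤uv ⟩
  p * (u * v)   ≡⟨ solve 3 (λ p u v → p :* (u :* v) := u :* (p :* v)) refl p u v ⟩
  u * (p * v)   ≤⟨ *-monoˡ-≤-nonNeg u {{nonNegative 0≤u}} pv≤w ⟩
  u * w         ∎
  where open ≤-Reasoning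

+-≤⇒≤- : ∀ {p q r} → p + q ≤ r → q ≤ r - p
+-≤⇒≤- {p} {q} {r} p+q≤r = subst (_≤ r - p) (p+q-p≡q p q) (+-monoˡ-≤ (- p) p+q≤r)

fromℕ-suc : ∀ k → fromℕ (suc k) ≡ 1ℚ + fromℕ k
fromℕ-suc k = sym (ratio-+ 1 k 0)

LowerBound : ℚ → List ℚ → Set
LowerBound α xs = ∀ k {r} → r ∈[ 0ℚ , α ] → ∑ xs ≤ fromℕ k * α + r →
                  (1ℚ - α) ^ℚ k * (1ℚ - r) ≤ ∏[1- xs ]

lowerBound-[] : ∀ {α} → α ≤ 1ℚ → LowerBound α []
lowerBound-[] α≤1 k (0≤r , r≤α) _ =
  proj₂ (*-∈[0,1] (^ℚ-∈[0,1] (1-∈[0,1] (≤-trans 0≤r r≤α , α≤1)) k)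
                  (1-∈[0,1] (0≤r , ≤-trans r≤α α≤1)))

-- The remainder r is the unused part of the last α-block of the budget: an x ≤ r is absorbed
-- into it, while a larger x opens a new block whose leftover is r + (α - x).
lowerBound-∷ : ∀ {α x xs} → α ≤ 1ℚ → x ∈[ 0ℚ , α ] → All (_∈[ 0ℚ , α ]) xs →
               LowerBound α xs → LowerBound α (x ∷ xs)
lowerBound-∷ {α} {x} {xs} α≤1 (0≤x , x≤α) xs∈ lowerBound-xs k {r} (0≤r , r≤α) = step (x ≤? r) k
  where
  0≤[1-α]^ : ∀ k → 0ℚ ≤ (1ℚ - α) ^ℚ k
  0≤[1-α]^ k = proj₁ (^ℚ-∈[0,1] (1-∈[0,1] (≤-trans 0≤x x≤α , α≤1)) k)
  0≤1-x : 0ℚ ≤ 1ℚ - x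
  0≤1-x = p≤q⇒0≤q-p (≤-trans x≤α α≤1)

  step : Dec (x ≤ r) → ∀ k → ∑ (x ∷ xs) ≤ fromℕ k * α + r →
         (1ℚ - α) ^ℚ k * (1ℚ - r) ≤ ∏[1- x ∷ xs ]
  step (yes x≤r) k budget =
    *-≤-via (0≤[1-α]^ k) 0≤1-x absorb (lowerBound-xs k (p≤q⇒0≤q-p x≤r , r-x≤α) budget′)
    where
    r-x≤α : r - x ≤ α
    r-x≤α = ≤-trans (subst (r - x ≤_) (+-identityʳ r) (+-monoʳ-≤ r (neg-antimono-≤ 0≤x))) r≤α
    budget′ : ∑ xs ≤ fromℕ k * α + (r - x)
    budget′ = subst (∑ xs ≤_) (+-assoc (fromℕ k * α) r (- x)) (+-≤⇒≤- budget)
    absorb : 1ℚ - r ≤ (1ℚ - x) * (1ℚ - (r - x))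
    absorb = subst (_≤ (1ℚ - x) * (1ℚ - (r - x))) (*-identityʳ (1ℚ - r))
      (1-*1-≤-spread 0≤x x≤r (solve 2 (λ r x → r :+ con 0ℚ := x :+ (r :- x)) refl r x))
  step (no x≰r) zero budget = ⊥-elim (<-irrefl refl (<-≤-trans (≰⇒> x≰r) (begin
    x                  ≤⟨ p≤p+q x (∑-nonNeg (All.map proj₁ xs∈)) ⟩
    ∑ (x ∷ xs)         ≤⟨ budget ⟩
    fromℕ 0 * α + r    ≡⟨ cong (_+ r) (*-zeroˡ α) ⟩
    0ℚ + r             ≡⟨ +-identityˡ r ⟩
    r                  ∎)))
    where open ≤-Reasoning
  step (no x≰r) (suc k) budget = subst (_≤ ∏[1- x ∷ xs ]) regroup
    (*-≤-via (0≤[1-α]^ k) 0≤1-x newBlock (lowerBound-xs k (0≤r′ , r′≤α) budget′))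
    where
    r≤x = <⇒≤ (≰⇒> x≰r)
    r′ = r + (α - x)
    0≤r′ : 0ℚ ≤ r′
    0≤r′ = +-mono-≤ 0≤r (p≤q⇒0≤q-p x≤α)
    r′≤α : r′ ≤ α
    r′≤α = subst (r′ ≤_) (solve 2 (λ x α → x :+ (α :- x) := α) refl x α) (+-monoˡ-≤ (α - x) r≤x)
    budget′ : ∑ xs ≤ fromℕ k * α + r′
    budget′ = subst (∑ xs ≤_)
      (trans (cong (λ n → n * α + r - x) (fromℕ-suc k))
             (solve 4 (λ n α r x → (con 1ℚ :+ n) :* α :+ r :- x := n :* α :+ (r :+ (α :- x)))
                      refl (fromℕ k) α r x))
      (+-≤⇒≤- budget)
    newBlock : (1ℚ - α) * (1ℚ - r) ≤ (1ℚ - x) * (1ℚ - r′)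
    newBlock = 1-*1-≤-spread r≤x x≤α (solve 3 (λ α r x → α :+ r := x :+ (r :+ (α :- x))) refl α r x)
    regroup : (1ℚ - α) ^ℚ k * ((1ℚ - α) * (1ℚ - r)) ≡ (1ℚ - α) ^ℚ suc k * (1ℚ - r)
    regroup = solve 3 (λ p a r → p :* (a :* r) := (a :* p) :* r) refl
                      ((1ℚ - α) ^ℚ k) (1ℚ - α) (1ℚ - r)

∏[1-]-lowerBound : ∀ {α xs} → α ≤ 1ℚ → All (_∈[ 0ℚ , α ]) xs → LowerBound α xs
∏[1-]-lowerBound α≤1 []          = lowerBound-[] α≤1
∏[1-]-lowerBound α≤1 (x∈ ∷ xs∈) = lowerBound-∷ α≤1 x∈ xs∈ (∏[1-]-lowerBound α≤1 xs∈)

count : ∀ {A : Set} → (A → Bool) → List A → ℕ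
count p xs = length (filter (λ x → T? (p x)) xs)

every : ∀ {A : Set} → (A → Bool) → List A → Bool
every ok = foldr (λ x b → ok x ∧ b) true

count-++ : ∀ {A : Set} (p : A → Bool) xs ys → count p (xs ++ ys) ≡ count p xs ℕ.+ count p ys
count-++ p xs ys =
  trans (cong length (filter-++ (λ x → T? (p x)) xs ys)) (length-++ (filter (λ x → T? (p x)) xs))

count-+-count-not : ∀ {A : Set} (p : A → Bool) xs →
                    count p xs ℕ.+ count (λ x → not (p x)) xs ≡ length xs
count-+-count-not p []       = refl
count-+-count-not p (x ∷ xs) with p x
... | true  = cong suc (count-+-count-not p xs)
... | false = trans (ℕₚ.+-suc (count p xs) _) (cong suc (count-+-count-not p xs))

count-every-map-∷ : ∀ {A : Set} (ok : A → Bool) x R →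
                    count (every ok) (map (x ∷_) R) ≡ (if ok x then count (every ok) R else 0)
count-every-map-∷ ok x [] with ok x
... | true  = refl
... | false = refl
count-every-map-∷ ok x (s ∷ R) with ok x | every ok s | count-every-map-∷ ok x R
... | true  | true  | ih = cong suc ih
... | true  | false | ih = ih
... | false | _     | ih = ih

module _ {A B : Set} (a : B → A) (R : List (List A)) where

  prefixed : List B → List (List A)
  prefixed = concatMap (λ v → map (a v ∷_) R)

  length-prefixed : ∀ vs → length (prefixed vs) ≡ length vs ℕ.* length R
  length-prefixed []       = refl
  length-prefixed (v ∷ vs) = begin
    length (map (a v ∷_) R ++ prefixed vs)
      ≡⟨ length-++ (map (a v ∷_) R) ⟩
    length (map (a v ∷_) R) ℕ.+ length (prefixed vs)
      ≡⟨ cong₂ ℕ._+_ (length-map (a v ∷_) R) (length-prefixed vs) ⟩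
    length R ℕ.+ length vs ℕ.* length R ∎
    where open ≡-Reasoning

  count-every-prefixed : ∀ (ok : A → Bool) vs →
    count (every ok) (prefixed vs) ≡ count (λ v → ok (a v)) vs ℕ.* count (every ok) R
  count-every-prefixed ok []       = refl
  count-every-prefixed ok (v ∷ vs) = begin
    count (every ok) (map (a v ∷_) R ++ prefixed vs)
      ≡⟨ count-++ (every ok) (map (a v ∷_) R) (prefixed vs) ⟩
    count (every ok) (map (a v ∷_) R) ℕ.+ count (every ok) (prefixed vs)
      ≡⟨ cong₂ ℕ._+_ (count-every-map-∷ ok (a v) R) (count-every-prefixed ok vs) ⟩
    (if ok (a v) then c else 0) ℕ.+ count (λ v → ok (a v)) vs ℕ.* c
      ≡⟨ head-count ⟩
    count (λ v → ok (a v)) (v ∷ vs) ℕ.* c ∎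
    where
    open ≡-Reasoning
    c = count (every ok) R
    head-count : (if ok (a v) then c else 0) ℕ.+ count (λ v → ok (a v)) vs ℕ.* c ≡
                 count (λ v → ok (a v)) (v ∷ vs) ℕ.* c
    head-count with ok (a v)
    ... | true  = refl
    ... | false = refl

module _ {n : ℕ} {G : SimpleGraph n} (H : DirectedSubgraph G) (C : EdgeSubset G) where

  ratio-avoiding-choicesFrom : ∀ us →
    ratio (count (avoidsC C) (choicesFrom H us)) (length (choicesFrom H us)) ≡ ∏[1- map (q H C) us ]
  ratio-avoiding-choicesFrom []       = refl
  ratio-avoiding-choicesFrom (u ∷ us) with outs H u
  ... | [] = trans (ratio-avoiding-choicesFrom us) (sym (*-identityˡ _))
  ... | vs@(_ ∷ vs′) = begin
    ratio (count (avoidsC C) (prefixed (u ,_) R vs)) (length (prefixed (u ,_) R vs))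
      ≡⟨ cong₂ ratio (count-every-prefixed (u ,_) R (λ e → not (inC C (proj₁ e) (proj₂ e))) vs)
                     (length-prefixed (u ,_) R vs) ⟩
    ratio (#outsNotInC ℕ.* #avoiding) (length vs ℕ.* length R)
      ≡⟨ ratio-* #outsNotInC (length vs) #avoiding (length R) ⟩
    ratio #outsNotInC (length vs) * ratio #avoiding (length R)
      ≡⟨ cong₂ _*_ (sym (ratio-complement #outsInC #outsNotInC (count-+-count-not (inC C u) vs)))
                   (ratio-avoiding-choicesFrom us) ⟩
    (1ℚ - ratio #outsInC (length vs)) * ∏[1- map (q H C) us ] ∎
    where
    open ≡-Reasoning
    R = choicesFrom H us
    #avoiding   = count (avoidsC C) R
    #outsInC    = count (inC C u) vs
    #outsNotInC = count (λ v → not (inC C u v)) vs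

corollary4p2 : ∀ {n : ℕ} (G : SimpleGraph n) (C : EdgeSubset G)
    (H : DirectedSubgraph G) (α β : ℚ) (α>0 : 0ℚ < α) → α ≤ 1ℚ →
    Good H C α β →
    ((1ℚ - α) ^ℚ ∣ ⌈ _÷_ β α {{>-nonZero α>0}} ⌉ ∣) ≤ probNoC H C
corollary4p2 {n} G C H α β α>0 α≤1 (q≤α , ∑q≤β) = begin
  (1ℚ - α) ^ℚ K                ≡⟨ *-identityʳ _ ⟨
  (1ℚ - α) ^ℚ K * (1ℚ - 0ℚ)    ≤⟨ ∏[1-]-lowerBound α≤1 q∈[0,α] K (≤-refl , 0≤α) budget ⟩
  ∏[1- qs ]                    ≡⟨ ratio-avoiding-choicesFrom H C (allFin n) ⟨
  probNoC H C                  ∎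
  where
  open ≤-Reasoning
  instance _ = >-nonZero α>0
  K  = ∣ ⌈ β ÷ α ⌉ ∣
  qs = map (q H C) (allFin n)
  0≤α = <⇒≤ α>0
  q∈[0,α] : All (_∈[ 0ℚ , α ]) qs
  q∈[0,α] = map⁺ (All.universal (λ u → ratio-nonNeg (outsInC H C u) (length (outs H u)) , q≤α u)
                                (allFin n))
  budget : ∑ qs ≤ fromℕ K * α + 0ℚ
  budget = ≤-trans ∑q≤β (subst (β ≤_) (sym (+-identityʳ _)) (≤-fromℕ-∣⌈÷⌉∣-* β α 0≤α))
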